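{- Let $G$ be a finite simple graph. If $\lambda(G)=\delta(G)$, then $\lambda(\mathcal{D}[G])=2\lambda(G)$, where $\lambda$ denotes edge-connectivity and $\delta$ minimum degree.
   Context: The total graph $T_2$ is $K_2$ with a loop added at each of its two vertices. The double graph is $\mathcal{D}[G]=G\times T_2$ (Kronecker product): it has vertex set $V(G)\times\{0,1\}$ and $(u,i)$ is adjacent to $(v,j)$ iff $uv\in E(G)$. -}

module Defs where

open import Data.Nat using (ℕ; zero; suc; _+_; _*_; _≤_; _<_)
open import Data.Bool using (Bool; true; false; _∧_; not; if_then_else_)
open import Data.Fin using (Fin; toℕ; remQuot)
open import Data.Fin.Properties using () renaming (_<?_ to _<ᶠ?_)
open import Data.List using (List; map; allFin)
open import Data.Nat.ListAction using (sum)
open import Data.Product using (_×_; _,_; proj₁; ∃; ∃-syntax)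
open import Relation.Binary.PropositionalEquality using (_≡_; refl; cong₂)
open import Relation.Nullary using (¬_; does)

record Graph (n : ℕ) : Set where
  field
    adj     : Fin n → Fin n → Bool
    sym     : ∀ u v → adj u v ≡ adj v u
    irrefl  : ∀ v → adj v v ≡ false
open Graph public

b2n : Bool → ℕ
b2n true  = 1
b2n false = 0

degree : ∀ {n} → Graph n → Fin n → ℕ
degree {n} G v = sum (map (λ u → b2n (adj G v u)) (allFin n))

IsMinDegree : ∀ {n} → Graph n → ℕ → Set
IsMinDegree {n} G k = (∃[ v ] degree G v ≡ k) × (∀ v → k ≤ degree G v)

record EdgeSet {n : ℕ} (G : Graph n) : Set where
  field
    mem    : Fin n → Fin n → Bool
    memSym : ∀ u v → mem u v ≡ mem v u
    sub    : ∀ u v → mem u v ≡ true → adj G u v ≡ true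
open EdgeSet public

-- number of edges in F (each unordered pair {u,v} counted once, via u < v)
size : ∀ {n} {G : Graph n} → EdgeSet G → ℕ
size {n} F = sum (map (λ u → sum (map (λ v →
  if does (u <ᶠ? v) then b2n (mem F u v) else 0) (allFin n))) (allFin n))

deleteEdges : ∀ {n} (G : Graph n) → EdgeSet G → Graph n
deleteEdges G F = record
  { adj    = λ u v → adj G u v ∧ not (mem F u v)
  ; sym    = λ u v → eqs u v
  ; irrefl = λ v → irr v
  }
  where
  eqs : ∀ u v → (adj G u v ∧ not (mem F u v)) ≡ (adj G v u ∧ not (mem F v u))
  eqs u v = cong₂ (λ a b → a ∧ not b) (sym G u v) (memSym F u v)
  irr : ∀ v → (adj G v v ∧ not (mem F v v)) ≡ false
  irr v rewrite irrefl G v = refl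

data Reach {n : ℕ} (G : Graph n) : Fin n → Fin n → Set where
  here : ∀ {u} → Reach G u u
  step : ∀ {u v w} → adj G u v ≡ true → Reach G v w → Reach G u w

Connected : ∀ {n} → Graph n → Set
Connected {n} G = ∀ (u v : Fin n) → Reach G u v

-- λ(G) = k : edge-connectivity, the minimum number of edges whose deletion
-- disconnects G; by the usual convention λ(G) = 0 when G has at most one vertex.
IsEdgeConnectivity : ∀ {n} → Graph n → ℕ → Set
IsEdgeConnectivity {n} G k =
  (n ≤ 1 → k ≡ 0) ×
  (2 ≤ n →
    (∃[ F ] (size {G = G} F ≡ k × ¬ Connected (deleteEdges G F))) ×
    (∀ (F : EdgeSet G) → ¬ Connected (deleteEdges G F) → k ≤ size F))

-- The double graph D[G] = G × T₂ on vertex set Fin (n * 2) ≅ Fin n × Fin 2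
-- (via remQuot): (u,i) ~ (v,j) iff u ~ v in G.
double : ∀ {n} → Graph n → Graph (n * 2)
double {n} G = record
  { adj    = λ x y → adj G (proj₁ (remQuot {n} 2 x)) (proj₁ (remQuot {n} 2 y))
  ; sym    = λ x y → sym G (proj₁ (remQuot {n} 2 x)) (proj₁ (remQuot {n} 2 y))
  ; irrefl = λ x → irrefl G (proj₁ (remQuot {n} 2 x))
  }

-- A set of edges whose removal disconnects a graph contains the edge cut ∂S of
-- the set S of vertices reachable from some vertex, so it suffices to bound the
-- edge cuts of D[G] from below.  Let S separate two vertices of D[G].  If S
-- contains exactly one copy of some vertex u, then for every neighbour v of u
-- exactly two of the four edges between the copies of u and of v cross S, so
-- |∂S| ≥ 2 deg u ≥ 2δ.  Otherwise S = T × {0,1} and |∂S| = 4 |∂_G T| ≥ 4λ.  With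
-- λ = δ both bounds are at least 2λ, and the edges at one copy of a vertex of
-- minimum degree form a cut of exactly that size.

module Submission where

open import Defs renaming (sym to adj-sym)

import Algebra.Properties.Semiring.Sum
open import Data.Bool using (Bool; true; false; _∧_; not; _xor_; if_then_else_)
open import Data.Bool.Properties
  using (∧-zeroʳ; ∧-identityʳ; ∧-conicalˡ; ∧-conicalʳ; xor-comm; xor-same)
  renaming (_≟_ to _≟ᵇ_)
open import Data.Empty using (⊥-elim)
open import Data.Fin using (Fin; zero; suc; _<_; combine; remQuot; punchIn; _↑ˡ_; _↑ʳ_)
open import Data.Fin.Patterns using (0F; 1F)
open import Data.Fin.Properties
  using (_≟_; _<?_; <-cmp; <-asym; punchInᵢ≢i; remQuot-combine; combine-remQuot;
         combine-injectiveʳ; all?; ¬∀⟶∃¬; sequence)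
open import Data.List using (map; allFin; tabulate)
open import Data.List.Properties using (map-tabulate)
open import Data.Nat using (ℕ; zero; suc; _+_; _*_; _≤_; _≤?_; z≤n; s≤s)
import Data.Nat.ListAction as List
open import Data.Nat.Properties
  using (+-*-semiring; +-assoc; +-identityʳ; *-zeroʳ; *-comm; *-assoc; *-cancelˡ-≡;
         ≤-refl; ≤-trans; m≤m+n; +-mono-≤; *-mono-≤; *-monoʳ-≤; *-cancelˡ-≤; module ≤-Reasoning)
open import Data.Product using (_×_; _,_; proj₁; proj₂; ∃-syntax)
open import Data.Vec.Functional using (_∷_; [])
open import Effect.Monad using (RawMonad)
open import Function using (_∘_)
open import Function.Bundles using (mk⇔)
open import Relation.Binary using (tri<; tri≈; tri>)
open import Relation.Binary.PropositionalEquality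
open import Relation.Nullary using (¬_; Dec; does; yes; no)
open import Relation.Nullary.Decidable
  using (decidable-stable; dec-true; dec-false; does-⇔; ¬¬-excluded-middle)
open import Relation.Nullary.Negation using (¬¬-Monad; ¬¬-map; contradiction)

open Algebra.Properties.Semiring.Sum +-*-semiring

-- Finite sums over Fin n

sum-tabulate : ∀ {n} (f : Fin n → ℕ) → List.sum (tabulate f) ≡ sum f
sum-tabulate {zero}  f = refl
sum-tabulate {suc n} f = cong (f zero +_) (sum-tabulate (f ∘ suc))

sum-allFin : ∀ {n} (f : Fin n → ℕ) → List.sum (map f (allFin n)) ≡ sum f
sum-allFin f = trans (cong List.sum (map-tabulate (λ i → i) f)) (sum-tabulate f)

∑-mono-≤ : ∀ {n} {f g : Fin n → ℕ} → (∀ i → f i ≤ g i) → sum f ≤ sum g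
∑-mono-≤ {zero}  f≤g = ≤-refl
∑-mono-≤ {suc n} f≤g = +-mono-≤ (f≤g zero) (∑-mono-≤ (f≤g ∘ suc))

∑-zero : ∀ {n} {f : Fin n → ℕ} → (∀ i → f i ≡ 0) → sum f ≡ 0
∑-zero {n} f≡0 = trans (sum-cong-≗ f≡0) (sum-replicate-zero n)

∑-↑ˡ-↑ʳ : ∀ a {b} (f : Fin (a + b) → ℕ) →
          sum f ≡ ∑[ i < a ] f (i ↑ˡ b) + ∑[ j < b ] f (a ↑ʳ j)
∑-↑ˡ-↑ʳ zero    f = refl
∑-↑ˡ-↑ʳ (suc a) f = trans (cong (f zero +_) (∑-↑ˡ-↑ʳ a (f ∘ suc))) (sym (+-assoc (f zero) _ _))

∑-combine : ∀ n k (f : Fin (n * k) → ℕ) → sum f ≡ ∑[ u < n ] ∑[ i < k ] f (combine u i)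
∑-combine zero    k f = refl
∑-combine (suc n) k f =
  trans (∑-↑ˡ-↑ʳ k f) (cong (∑[ i < k ] f (i ↑ˡ (n * k)) +_) (∑-combine n k (f ∘ (k ↑ʳ_))))

private
  ∑∑-row-col-rest : ∀ {n} (N : Fin (suc n) → Fin (suc n) → ℕ) c → N c c ≡ 0 →
    ∑[ u < suc n ] ∑[ v < suc n ] N u v ≡
    (∑[ v < suc n ] N c v + ∑[ u < suc n ] N u c) + ∑[ j < n ] ∑[ l < n ] N (punchIn c j) (punchIn c l)
  ∑∑-row-col-rest {n} N c Ncc≡0 = begin
    ∑[ u < suc n ] ∑[ v < suc n ] N u v
      ≡⟨ sum-remove {i = c} (λ u → ∑[ v < suc n ] N u v) ⟩
    row + ∑[ j < n ] ∑[ v < suc n ] N (punchIn c j) v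
      ≡⟨ cong (row +_) (sum-cong-≗ (λ j → sum-remove {i = c} (N (punchIn c j)))) ⟩
    row + ∑[ j < n ] (N (punchIn c j) c + ∑[ l < n ] N (punchIn c j) (punchIn c l))
      ≡⟨ cong (row +_) (∑-distrib-+ (λ j → N (punchIn c j) c)
                                    (λ j → ∑[ l < n ] N (punchIn c j) (punchIn c l))) ⟩
    row + (∑[ j < n ] N (punchIn c j) c + rest)
      ≡⟨ cong (λ x → row + (x + rest)) col≡ ⟨
    row + (col + rest)
      ≡⟨ +-assoc row col rest ⟨
    (row + col) + rest ∎
    where
    open ≡-Reasoning
    row = ∑[ v < suc n ] N c v
    col = ∑[ u < suc n ] N u c
    rest = ∑[ j < n ] ∑[ l < n ] N (punchIn c j) (punchIn c l)
    col≡ : col ≡ ∑[ j < n ] N (punchIn c j) c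
    col≡ = trans (sum-remove {i = c} (λ u → N u c)) (cong (_+ ∑[ j < n ] N (punchIn c j) c) Ncc≡0)

row+col≤∑∑ : ∀ {n} (N : Fin n → Fin n → ℕ) c → N c c ≡ 0 →
  ∑[ v < n ] N c v + ∑[ u < n ] N u c ≤ ∑[ u < n ] ∑[ v < n ] N u v
row+col≤∑∑ {suc n} N c Ncc≡0 =
  subst (row + col ≤_) (sym (∑∑-row-col-rest N c Ncc≡0)) (m≤m+n (row + col) _)
  where
  row = ∑[ v < suc n ] N c v
  col = ∑[ u < suc n ] N u c

∑∑-row-col : ∀ {n} (N : Fin n → Fin n → ℕ) c → N c c ≡ 0 →
  (∀ u v → u ≢ c → v ≢ c → N u v ≡ 0) →
  ∑[ u < n ] ∑[ v < n ] N u v ≡ ∑[ v < n ] N c v + ∑[ u < n ] N u c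
∑∑-row-col {suc n} N c Ncc≡0 rest≡0 =
  trans (∑∑-row-col-rest N c Ncc≡0) (trans (cong (row + col +_) rest-sum≡0) (+-identityʳ (row + col)))
  where
  row = ∑[ v < suc n ] N c v
  col = ∑[ u < suc n ] N u c
  rest-sum≡0 : ∑[ j < n ] ∑[ l < n ] N (punchIn c j) (punchIn c l) ≡ 0
  rest-sum≡0 = ∑-zero (λ j → ∑-zero (λ l → rest≡0 _ _ (punchInᵢ≢i c j) (punchInᵢ≢i c l)))

-- Degrees and edge counts

upper : ∀ {m} → (Fin m → Fin m → Bool) → Fin m → Fin m → ℕ
upper M u v = if does (u <? v) then b2n (M u v) else 0

b2n≡upper+upper : ∀ {m} (M : Fin m → Fin m → Bool) →
  (∀ u v → M u v ≡ M v u) → (∀ u → M u u ≡ false) →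
  ∀ u v → b2n (M u v) ≡ upper M u v + upper M v u
b2n≡upper+upper M M-sym M-irrefl u v = by-order (u <? v) (v <? u)
  where
  by-order : (u<?v : Dec (u < v)) (v<?u : Dec (v < u)) →
    b2n (M u v) ≡ (if does u<?v then b2n (M u v) else 0) + (if does v<?u then b2n (M v u) else 0)
  by-order (yes u<v) (yes v<u) = ⊥-elim (<-asym u<v v<u)
  by-order (yes _)   (no _)    = sym (+-identityʳ _)
  by-order (no _)    (yes _)   = cong b2n (M-sym u v)
  by-order (no u≮v)  (no v≮u)  with <-cmp u v
  ... | tri< u<v _ _  = ⊥-elim (u≮v u<v)
  ... | tri> _ _ v<u  = ⊥-elim (v≮u v<u)
  ... | tri≈ _ refl _ = cong b2n (M-irrefl u)

degree≡∑ : ∀ {m} (H : Graph m) v → degree H v ≡ ∑[ u < m ] b2n (adj H v u)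
degree≡∑ {m} H v = sum-allFin {m} _

module _ {m} {H : Graph m} where

  size≡∑∑upper : (F : EdgeSet H) → size F ≡ ∑[ u < m ] ∑[ v < m ] upper (mem F) u v
  size≡∑∑upper F = trans (sum-allFin {m} _) (sum-cong-≗ {m} (λ u → sum-allFin {m} _))

  mem-irrefl : (F : EdgeSet H) → ∀ u → mem F u u ≡ false
  mem-irrefl F u with mem F u u in uu∈F
  ... | false = refl
  ... | true  = trans (sym (sub F u u uu∈F)) (irrefl H u)

  ∑∑-mem≡2*size : (F : EdgeSet H) → ∑[ u < m ] ∑[ v < m ] b2n (mem F u v) ≡ 2 * size F
  ∑∑-mem≡2*size F = begin
    ∑[ u < m ] ∑[ v < m ] b2n (mem F u v)
      ≡⟨ sum-cong-≗ (λ u → sum-cong-≗ (b2n≡upper+upper (mem F) (memSym F) (mem-irrefl F) u)) ⟩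
    ∑[ u < m ] ∑[ v < m ] (upper (mem F) u v + upper (mem F) v u)
      ≡⟨ sum-cong-≗ (λ u → ∑-distrib-+ (upper (mem F) u) (λ v → upper (mem F) v u)) ⟩
    ∑[ u < m ] (∑[ v < m ] upper (mem F) u v + ∑[ v < m ] upper (mem F) v u)
      ≡⟨ ∑-distrib-+ (λ u → ∑[ v < m ] upper (mem F) u v) (λ u → ∑[ v < m ] upper (mem F) v u) ⟩
    S + ∑[ u < m ] ∑[ v < m ] upper (mem F) v u
      ≡⟨ cong (S +_) (∑-comm (λ v u → upper (mem F) v u)) ⟨
    S + S
      ≡⟨ cong (S +_) (+-identityʳ S) ⟨
    2 * S
      ≡⟨ cong (2 *_) (size≡∑∑upper F) ⟨
    2 * size F ∎
    where
    open ≡-Reasoning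
    S = ∑[ u < m ] ∑[ v < m ] upper (mem F) u v

-- Edge cuts

cut : ∀ {m} (H : Graph m) → (Fin m → Bool) → EdgeSet H
cut H s = record
  { mem    = λ u v → adj H u v ∧ (s u xor s v)
  ; memSym = λ u v → cong₂ _∧_ (adj-sym H u v) (xor-comm (s u) (s v))
  ; sub    = λ u v → ∧-conicalˡ _ _
  }

Separates : ∀ {m} → (Fin m → Bool) → Set
Separates s = ∃[ x ] ∃[ y ] (s x ≡ true × s y ≡ false)

_⊆_ : ∀ {m} {H : Graph m} → EdgeSet H → EdgeSet H → Set
_⊆_ {m} F F′ = ∀ (u v : Fin m) → mem F u v ≡ true → mem F′ u v ≡ true

separates⇒2≤ : ∀ {m} {s : Fin m → Bool} → Separates s → 2 ≤ m
separates⇒2≤ {suc zero}    (zero , zero , sx , sy) with trans (sym sx) sy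
... | ()
separates⇒2≤ {suc (suc m)} _ = s≤s (s≤s z≤n)

Reach-snoc : ∀ {m} {H : Graph m} {u v w} → Reach H u v → adj H v w ≡ true → Reach H u w
Reach-snoc here       vw = step vw here
Reach-snoc (step e r) vw = step e (Reach-snoc r vw)

kept-edge-same-side : ∀ a p q → a ∧ not (a ∧ (p xor q)) ≡ true → p ≡ q
kept-edge-same-side true true  true  _ = refl
kept-edge-same-side true false false _ = refl

xor≡true⇒≢ : ∀ {p q} → p xor q ≡ true → p ≢ q
xor≡true⇒≢ {p} p⊕p≡true refl with trans (sym p⊕p≡true) (xor-same p)
... | ()

module _ {m} {H : Graph m} where

  size-mono : {F F′ : EdgeSet H} → F ⊆ F′ → size F ≤ size F′
  size-mono {F} {F′} F⊆F′ = *-cancelˡ-≤ 2 (begin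
    2 * size F                             ≡⟨ ∑∑-mem≡2*size F ⟨
    ∑[ u < m ] ∑[ v < m ] b2n (mem F u v)  ≤⟨ ∑-mono-≤ (λ u → ∑-mono-≤ (b2n-mono ∘ F⊆F′ u)) ⟩
    ∑[ u < m ] ∑[ v < m ] b2n (mem F′ u v) ≡⟨ ∑∑-mem≡2*size F′ ⟩
    2 * size F′                            ∎)
    where
    open ≤-Reasoning
    b2n-mono : ∀ {a b} → (a ≡ true → b ≡ true) → b2n a ≤ b2n b
    b2n-mono {false} _   = z≤n
    b2n-mono {true}  a⇒b rewrite a⇒b refl = ≤-refl

  Reach-cut-side : ∀ {s u v} → Reach (deleteEdges H (cut H s)) u v → s u ≡ s v
  Reach-cut-side here                   = refl
  Reach-cut-side (step {u} {w} uw kept) = trans (kept-edge-same-side (adj H u w) _ _ uw) (Reach-cut-side kept)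

  cut-disconnects : ∀ {s} → Separates s → ¬ Connected (deleteEdges H (cut H s))
  cut-disconnects (x , y , sx , sy) connected with trans (sym sx) (trans (Reach-cut-side (connected x y)) sy)
  ... | ()

  -- The argument is classical, but the goal is a decidable inequality, so it may
  -- assume that reachability in H − F is decidable.
  disconnecting-bound : ∀ {k} → (∀ s → Separates s → k ≤ size (cut H s)) →
                        ∀ F → ¬ Connected (deleteEdges H F) → k ≤ size F
  disconnecting-bound {k} cut-bound F disconnected =
    decidable-stable (k ≤? size F) (¬¬-map bound ¬¬-reach?)
    where
    H−F = deleteEdges H F

    ¬¬-reach? : ¬ ¬ (∀ x y → Dec (Reach H−F x y))
    ¬¬-reach? = sequence ¬¬-applicative (λ x → sequence ¬¬-applicative (λ y → ¬¬-excluded-middle))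
      where ¬¬-applicative = RawMonad.rawApplicative ¬¬-Monad

    bound : (∀ x y → Dec (Reach H−F x y)) → k ≤ size F
    bound reach? with ¬∀⟶∃¬ m _ (λ x → all? (reach? x)) disconnected
    ... | x , ¬x→all with ¬∀⟶∃¬ m _ (reach? x) ¬x→all
    ...   | y , ¬x→y =
      ≤-trans (cut-bound s (x , y , dec-true (reach? x x) here , dec-false (reach? x y) ¬x→y))
              (size-mono {cut H s} {F} cut⊆F)
      where
      s : Fin m → Bool
      s = does ∘ reach? x

      edge-same-side : ∀ {a b} → adj H−F a b ≡ true → s a ≡ s b
      edge-same-side {a} {b} ab =
        does-⇔ (mk⇔ (λ r → Reach-snoc r ab) (λ r → Reach-snoc r (trans (adj-sym H−F b a) ab)))
               (reach? x a) (reach? x b)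

      cut⊆F : cut H s ⊆ F
      cut⊆F a b ab∈cut with mem F a b in mem-ab
      ... | true  = refl
      ... | false =
        contradiction (edge-same-side (cong₂ (λ p q → p ∧ not q) (∧-conicalˡ _ _ ab∈cut) mem-ab))
                      (xor≡true⇒≢ (∧-conicalʳ _ _ ab∈cut))

⁅_⁆ : ∀ {m} → Fin m → Fin m → Bool
⁅ x ⁆ z = does (z ≟ x)

⁅⁆-separates : ∀ {m} {x y : Fin m} → y ≢ x → Separates ⁅ x ⁆
⁅⁆-separates {x = x} {y} y≢x = x , y , dec-true (x ≟ x) refl , dec-false (y ≟ x) y≢x

cut-⁅⁆-at : ∀ {m} (H : Graph m) x v → mem (cut H ⁅ x ⁆) x v ≡ adj H x v
cut-⁅⁆-at H x v =
  trans (cong (λ b → adj H x v ∧ (b xor ⁅ x ⁆ v)) (dec-true (x ≟ x) refl)) (by-cases (v ≟ x))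
  where
  by-cases : (v≟x : Dec (v ≡ x)) → adj H x v ∧ not (does v≟x) ≡ adj H x v
  by-cases (yes refl) = trans (∧-zeroʳ _) (sym (irrefl H x))
  by-cases (no _)     = ∧-identityʳ _

size-cut-⁅⁆ : ∀ {m} (H : Graph m) x → size (cut H ⁅ x ⁆) ≡ degree H x
size-cut-⁅⁆ {m} H x = *-cancelˡ-≡ _ _ 2 (begin
  2 * size C                             ≡⟨ ∑∑-mem≡2*size C ⟨
  ∑[ u < m ] ∑[ v < m ] b2n (mem C u v)  ≡⟨ ∑∑-row-col (λ u v → b2n (mem C u v)) x
                                              (cong b2n (mem-irrefl C x)) away-from-x ⟩
  row + ∑[ u < m ] b2n (mem C u x)       ≡⟨ cong (row +_) (sum-cong-≗ (λ u → cong b2n (memSym C u x))) ⟩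
  row + row                              ≡⟨ cong (row +_) (+-identityʳ row) ⟨
  2 * row                                ≡⟨ cong (2 *_) (sum-cong-≗ (λ v → cong b2n (cut-⁅⁆-at H x v))) ⟩
  2 * ∑[ v < m ] b2n (adj H x v)         ≡⟨ cong (2 *_) (degree≡∑ H x) ⟨
  2 * degree H x                         ∎)
  where
  open ≡-Reasoning
  C = cut H ⁅ x ⁆
  row = ∑[ v < m ] b2n (mem C x v)
  away-from-x : ∀ u v → u ≢ x → v ≢ x → b2n (mem C u v) ≡ 0
  away-from-x u v u≢x v≢x rewrite dec-false (u ≟ x) u≢x | dec-false (v ≟ x) v≢x = cong b2n (∧-zeroʳ _)

-- Edge cuts of the double graph

crossings : (Fin 2 → Bool) → (Fin 2 → Bool) → ℕ
crossings p q = ∑[ i < 2 ] ∑[ j < 2 ] b2n (p i xor q j)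

∑-xor-split : ∀ {p : Fin 2 → Bool} → p 0F ≢ p 1F → ∀ b → ∑[ i < 2 ] b2n (p i xor b) ≡ 1
∑-xor-split {p} p₀≢p₁ b = on-values (p 0F) (p 1F) b p₀≢p₁
  where
  on-values : ∀ a₀ a₁ b → a₀ ≢ a₁ → ∑[ i < 2 ] b2n ((a₀ ∷ a₁ ∷ []) i xor b) ≡ 1
  on-values false false _     a₀≢a₁ = ⊥-elim (a₀≢a₁ refl)
  on-values true  true  _     a₀≢a₁ = ⊥-elim (a₀≢a₁ refl)
  on-values false true  false _     = refl
  on-values false true  true  _     = refl
  on-values true  false false _     = refl
  on-values true  false true  _     = refl

crossings-splitˡ : ∀ {p q} → p 0F ≢ p 1F → crossings p q ≡ 2
crossings-splitˡ {p} {q} p-split =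
  trans (∑-comm (λ i j → b2n (p i xor q j))) (sum-cong-≗ (∑-xor-split {p} p-split ∘ q))

crossings-splitʳ : ∀ {p q} → q 0F ≢ q 1F → crossings p q ≡ 2
crossings-splitʳ {p} {q} q-split =
  sum-cong-≗ (λ i → trans (sum-cong-≗ (λ j → cong b2n (xor-comm (p i) (q j))))
                          (∑-xor-split {q} q-split (p i)))

crossings-unsplit : ∀ {p q} → p 0F ≡ p 1F → q 0F ≡ q 1F → crossings p q ≡ 4 * b2n (p 0F xor q 0F)
crossings-unsplit {p} {q} = on-values (p 0F) (p 1F) (q 0F) (q 1F)
  where
  on-values : ∀ a₀ a₁ b₀ b₁ → a₀ ≡ a₁ → b₀ ≡ b₁ →
              crossings (a₀ ∷ a₁ ∷ []) (b₀ ∷ b₁ ∷ []) ≡ 4 * b2n (a₀ xor b₀)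
  on-values false _ false _ refl refl = refl
  on-values false _ true  _ refl refl = refl
  on-values true  _ false _ refl refl = refl
  on-values true  _ true  _ refl refl = refl

b2n-∧ : ∀ a b → b2n (a ∧ b) ≡ b2n a * b2n b
b2n-∧ false b = refl
b2n-∧ true  b = sym (+-identityʳ (b2n b))

module _ {n} (G : Graph n) where

  layers : (Fin (n * 2) → Bool) → Fin n → Fin 2 → Bool
  layers s u i = s (combine u i)

  adj-double : ∀ u i v j → adj (double G) (combine u i) (combine v j) ≡ adj G u v
  adj-double u i v j = cong₂ (adj G) (cong proj₁ (remQuot-combine u i)) (cong proj₁ (remQuot-combine v j))

  ∑-adj-*2 : ∀ v → ∑[ u < n ] (b2n (adj G v u) * 2) ≡ 2 * degree G v
  ∑-adj-*2 v = begin
    ∑[ u < n ] (b2n (adj G v u) * 2) ≡⟨ sum-cong-≗ (λ u → *-comm (b2n (adj G v u)) 2) ⟩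
    ∑[ u < n ] (2 * b2n (adj G v u)) ≡⟨ *-distribˡ-sum 2 (b2n ∘ adj G v) ⟨
    2 * ∑[ u < n ] b2n (adj G v u)   ≡⟨ cong (2 *_) (degree≡∑ G v) ⟨
    2 * degree G v                   ∎
    where open ≡-Reasoning

  degree-double : ∀ v i → degree (double G) (combine v i) ≡ 2 * degree G v
  degree-double v i = begin
    degree (double G) (combine v i)
      ≡⟨ degree≡∑ (double G) (combine v i) ⟩
    ∑[ b < n * 2 ] b2n (adj (double G) (combine v i) b)
      ≡⟨ ∑-combine n 2 (λ b → b2n (adj (double G) (combine v i) b)) ⟩
    ∑[ u < n ] ∑[ j < 2 ] b2n (adj (double G) (combine v i) (combine u j))
      ≡⟨ sum-cong-≗ (λ u → sum-cong-≗ (λ j → cong b2n (adj-double v i u j))) ⟩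
    ∑[ u < n ] (2 * b2n (adj G v u))
      ≡⟨ sum-cong-≗ (λ u → *-comm 2 (b2n (adj G v u))) ⟩
    ∑[ u < n ] (b2n (adj G v u) * 2)
      ≡⟨ ∑-adj-*2 v ⟩
    2 * degree G v ∎
    where open ≡-Reasoning

  ∑∑-cut-double : ∀ s → 2 * size (cut (double G) s) ≡
                  ∑[ u < n ] ∑[ v < n ] (b2n (adj G u v) * crossings (layers s u) (layers s v))
  ∑∑-cut-double s = begin
    2 * size (cut (double G) s)
      ≡⟨ ∑∑-mem≡2*size (cut (double G) s) ⟨
    ∑[ a < n * 2 ] ∑[ b < n * 2 ] w a b
      ≡⟨ ∑-combine n 2 (λ a → ∑[ b < n * 2 ] w a b) ⟩
    ∑[ u < n ] ∑[ i < 2 ] ∑[ b < n * 2 ] w (combine u i) b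
      ≡⟨ sum-cong-≗ {n} (λ u → sum-cong-≗ {2} (λ i → ∑-combine n 2 (w (combine u i)))) ⟩
    ∑[ u < n ] ∑[ i < 2 ] ∑[ v < n ] ∑[ j < 2 ] w (combine u i) (combine v j)
      ≡⟨ sum-cong-≗ {n} (λ u → ∑-comm {2} {n} (λ i v → ∑[ j < 2 ] w (combine u i) (combine v j))) ⟩
    ∑[ u < n ] ∑[ v < n ] ∑[ i < 2 ] ∑[ j < 2 ] w (combine u i) (combine v j)
      ≡⟨ sum-cong-≗ (λ u → sum-cong-≗ (λ v → sum-cong-≗ (λ i → sum-cong-≗ (w-combine u v i)))) ⟩
    ∑[ u < n ] ∑[ v < n ] ∑[ i < 2 ] ∑[ j < 2 ] (b2n (adj G u v) * b2n (σ u i xor σ v j))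
      ≡⟨ sum-cong-≗ (λ u → sum-cong-≗ (λ v →
           distrib₂ (b2n (adj G u v)) (λ i j → b2n (σ u i xor σ v j)))) ⟨
    ∑[ u < n ] ∑[ v < n ] (b2n (adj G u v) * crossings (σ u) (σ v)) ∎
    where
    open ≡-Reasoning
    σ = layers s
    w : Fin (n * 2) → Fin (n * 2) → ℕ
    w a b = b2n (mem (cut (double G) s) a b)
    w-combine : ∀ u v i j → w (combine u i) (combine v j) ≡ b2n (adj G u v) * b2n (σ u i xor σ v j)
    w-combine u v i j = trans (cong (λ e → b2n (e ∧ (σ u i xor σ v j))) (adj-double u i v j))
                              (b2n-∧ (adj G u v) (σ u i xor σ v j))
    distrib₂ : ∀ x (f : Fin 2 → Fin 2 → ℕ) →
               x * ∑[ i < 2 ] ∑[ j < 2 ] f i j ≡ ∑[ i < 2 ] ∑[ j < 2 ] (x * f i j)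
    distrib₂ x f =
      trans (*-distribˡ-sum x (λ i → ∑[ j < 2 ] f i j)) (sum-cong-≗ (λ i → *-distribˡ-sum x (f i)))

  size-cut-double-split : ∀ s c → layers s c 0F ≢ layers s c 1F → 2 * degree G c ≤ size (cut (double G) s)
  size-cut-double-split s c c-split = *-cancelˡ-≤ 2 (begin
    2 * (2 * degree G c)                ≡⟨ cong (2 * degree G c +_) (+-identityʳ (2 * degree G c)) ⟩
    2 * degree G c + 2 * degree G c     ≡⟨ cong₂ _+_ row≡ col≡ ⟨
    ∑[ v < n ] N c v + ∑[ u < n ] N u c ≤⟨ row+col≤∑∑ N c Ncc≡0 ⟩
    ∑[ u < n ] ∑[ v < n ] N u v         ≡⟨ ∑∑-cut-double s ⟨
    2 * size (cut (double G) s)         ∎)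
    where
    open ≤-Reasoning
    σ = layers s
    N : Fin n → Fin n → ℕ
    N u v = b2n (adj G u v) * crossings (σ u) (σ v)
    Ncc≡0 : N c c ≡ 0
    Ncc≡0 = cong (λ e → b2n e * crossings (σ c) (σ c)) (irrefl G c)
    row≡ : ∑[ v < n ] N c v ≡ 2 * degree G c
    row≡ = trans (sum-cong-≗ (λ v → cong (b2n (adj G c v) *_) (crossings-splitˡ {σ c} {σ v} c-split)))
                 (∑-adj-*2 c)
    col≡ : ∑[ u < n ] N u c ≡ 2 * degree G c
    col≡ = trans (sum-cong-≗ (λ u → cong₂ (λ e x → b2n e * x) (adj-sym G u c)
                                                         (crossings-splitʳ {σ u} {σ c} c-split)))
                 (∑-adj-*2 c)

  size-cut-double-unsplit : ∀ s → (∀ u → layers s u 0F ≡ layers s u 1F) →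
                            size (cut (double G) s) ≡ 4 * size (cut G (λ u → layers s u 0F))
  size-cut-double-unsplit s unsplit = *-cancelˡ-≡ _ _ 2 (begin
    2 * size (cut (double G) s)
      ≡⟨ ∑∑-cut-double s ⟩
    ∑[ u < n ] ∑[ v < n ] (b2n (adj G u v) * crossings (σ u) (σ v))
      ≡⟨ sum-cong-≗ (λ u → sum-cong-≗ (λ v → cong (b2n (adj G u v) *_)
           (crossings-unsplit {σ u} {σ v} (unsplit u) (unsplit v)))) ⟩
    ∑[ u < n ] ∑[ v < n ] (b2n (adj G u v) * (4 * b2n (t u xor t v)))
      ≡⟨ sum-cong-≗ (λ u → sum-cong-≗ (λ v → mask (adj G u v) (t u xor t v))) ⟩
    ∑[ u < n ] ∑[ v < n ] (4 * b2n (mem (cut G t) u v))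
      ≡⟨ sum-cong-≗ (λ u → *-distribˡ-sum 4 (λ v → b2n (mem (cut G t) u v))) ⟨
    ∑[ u < n ] (4 * ∑[ v < n ] b2n (mem (cut G t) u v))
      ≡⟨ *-distribˡ-sum 4 (λ u → ∑[ v < n ] b2n (mem (cut G t) u v)) ⟨
    4 * ∑[ u < n ] ∑[ v < n ] b2n (mem (cut G t) u v)
      ≡⟨ cong (4 *_) (∑∑-mem≡2*size (cut G t)) ⟩
    4 * (2 * size (cut G t))
      ≡⟨ trans (sym (*-assoc 4 2 (size (cut G t)))) (*-assoc 2 4 (size (cut G t))) ⟩
    2 * (4 * size (cut G t)) ∎)
    where
    open ≡-Reasoning
    σ = layers s
    t = λ u → σ u 0F
    mask : ∀ a b → b2n a * (4 * b2n b) ≡ 4 * b2n (a ∧ b)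
    mask false b = sym (*-zeroʳ 4)
    mask true  b = +-identityʳ (4 * b2n b)

  unsplit-separates : ∀ s → (∀ u → layers s u 0F ≡ layers s u 1F) →
                      Separates s → Separates (λ u → layers s u 0F)
  unsplit-separates s unsplit (x , y , sx , sy) =
    vertex x , vertex y , trans (sym (on-layer₀ x)) sx , trans (sym (on-layer₀ y)) sy
    where
    vertex : Fin (n * 2) → Fin n
    vertex a = proj₁ (remQuot {n} 2 a)
    layer-irrelevant : ∀ u i → layers s u i ≡ layers s u 0F
    layer-irrelevant u 0F = refl
    layer-irrelevant u 1F = sym (unsplit u)
    on-layer₀ : ∀ a → s a ≡ layers s (vertex a) 0F
    on-layer₀ a = trans (cong s (sym (combine-remQuot {n} 2 a)))
                        (layer-irrelevant (vertex a) (proj₂ (remQuot {n} 2 a)))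

  double-cut-bound : ∀ {k} → (∀ t → Separates t → k ≤ size (cut G t)) → (∀ v → k ≤ degree G v) →
                     ∀ s → Separates s → 2 * k ≤ size (cut (double G) s)
  double-cut-bound {k} cut-bound min-degree s s-separates with all? (λ u → layers s u 0F ≟ᵇ layers s u 1F)
  ... | yes unsplit = begin
    2 * k                   ≤⟨ *-mono-≤ {2} {4} (s≤s (s≤s z≤n)) (cut-bound t t-separates) ⟩
    4 * size (cut G t)      ≡⟨ size-cut-double-unsplit s unsplit ⟨
    size (cut (double G) s) ∎
    where
    open ≤-Reasoning
    t = λ u → layers s u 0F
    t-separates = unsplit-separates s unsplit s-separates
  ... | no ¬unsplit with ¬∀⟶∃¬ n _ (λ u → layers s u 0F ≟ᵇ layers s u 1F) ¬unsplit
  ...   | c , c-split = ≤-trans (*-monoʳ-≤ 2 (min-degree c)) (size-cut-double-split s c c-split)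

corollary3p2 : ∀ (n : ℕ) (G : Graph n) (k : ℕ) →
    IsEdgeConnectivity G k → IsMinDegree G k →
    IsEdgeConnectivity (double G) (2 * k)
corollary3p2 n G k (trivial , nontrivial) ((v , degree-v) , min-degree) =
  trivial-double n trivial ,
  λ _ → (cut (double G) ⁅ x ⁆ , size-star , cut-disconnects (⁅⁆-separates other-copy≢x)) ,
        disconnecting-bound (double-cut-bound G cut-bound min-degree)
  where
  x = combine v 0F

  trivial-double : ∀ n → (n ≤ 1 → k ≡ 0) → n * 2 ≤ 1 → 2 * k ≡ 0
  trivial-double zero    k≡0 _           = cong (2 *_) (k≡0 z≤n)
  trivial-double (suc n) _   (s≤s ())

  size-star : size (cut (double G) ⁅ x ⁆) ≡ 2 * k
  size-star = trans (size-cut-⁅⁆ (double G) x) (trans (degree-double G v 0F) (cong (2 *_) degree-v))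

  other-copy≢x : combine v 1F ≢ x
  other-copy≢x eq with combine-injectiveʳ v 1F v 0F eq
  ... | ()

  cut-bound : ∀ t → Separates t → k ≤ size (cut G t)
  cut-bound t t-separates = proj₂ (nontrivial (separates⇒2≤ t-separates)) (cut G t) (cut-disconnects t-separates)
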